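{- Let $\mathcal{M}=\langle S,\nu,V\rangle$ be a neighbourhood model. (1) If $\mathcal{M}$ is monotonic, then $\mathcal{M}$ is image-finite as a monotonic neighbourhood model iff $\mathcal{M}$ is image-finite as a neighbourhood model. (2) If $\mathcal{M}$ is augmented, then the Kripke model $\mathrm{krp}(\mathcal{M})$ is image-finite iff $\mathcal{M}$ is image-finite as a neighbourhood model.
   Context: A neighbourhood model $\langle S,\nu,V\rangle$ has $\nu\colon S\to\mathcal{P}(\mathcal{P}(S))$. It is image-finite (as a neighbourhood model) if for every $s\in S$ there are a finite $Y\subseteq S$ and $W\subseteq\mathcal{P}(Y)$ with $\nu(s)=\{D\subseteq S\mid D\cap Y\in W\}$. It is monotonic if each $\nu(s)$ is closed under supersets. A monotonic model is image-finite as a monotonic neighbourhood model if for every $s$ there are finitely many finite sets $C_1,\dots,C_n\subseteq S$ with $\nu(s)=\uparrow C_1\cup\dots\cup\uparrow C_n$, where $\uparrow C=\{C'\subseteq S\mid C\subseteq C'\}$. $\mathcal{M}$ is augmented if it is monotonic and $\bigcap\nu(s)\in\nu(s)$ for all $s$; then $\mathrm{krp}(\mathcal{M})=\langle S,R,V\rangle$ is the Kripke model with $R[s]=\bigcap\nu(s)$. A Kripke model is image-finite if every state has finitely many $R$-successors. -}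

module Defs where

open import Level using (Level; 0ℓ; suc)
open import Data.List using (List)
open import Data.List.Membership.Propositional using (_∈_)
open import Data.List.Relation.Unary.Any using (Any)
open import Data.Product using (Σ; ∃; _×_)
open import Function.Bundles using (_⇔_)
open import Relation.Unary using (Pred; _⊆_; _≐_; _∩_)

-- Subsets of S are predicates S → Set; a "set of subsets" is a predicate on
-- such predicates, required to be extensional (invariant under ≐).
ExtensionalFamily : {S : Set} → Pred (Pred S 0ℓ) 0ℓ → Set₁
ExtensionalFamily {S} 𝒲 = ∀ (D D′ : Pred S 0ℓ) → D ≐ D′ → 𝒲 D → 𝒲 D′

⟦_⟧ : {S : Set} → List S → Pred S 0ℓ
⟦ Y ⟧ x = x ∈ Y

record NeighbourhoodModel (At : Set) : Set₁ where
  field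
    S     : Set
    ν     : S → Pred (Pred S 0ℓ) 0ℓ
    ν-ext : ∀ s → ExtensionalFamily (ν s)
    V     : At → Pred S 0ℓ

-- Kripke model ⟨S, R, V⟩ (relation valued in Set₁ because R[s] = ⋂ν(s)
-- quantifies over subsets of S).
record KripkeModel (At : Set) : Set₂ where
  field
    S : Set
    R : S → S → Set₁
    V : At → Pred S 0ℓ

module _ {At : Set} (M : NeighbourhoodModel At) where
  open NeighbourhoodModel M

  ImageFiniteNM : Set₁
  ImageFiniteNM = ∀ (s : S) → Σ (List S) λ Y → Σ (Pred (Pred S 0ℓ) 0ℓ) λ W →
    ExtensionalFamily W × (∀ E → W E → E ⊆ ⟦ Y ⟧) ×
    (∀ (D : Pred S 0ℓ) → ν s D ⇔ W (D ∩ ⟦ Y ⟧))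

  Monotonic : Set₁
  Monotonic = ∀ (s : S) (D D′ : Pred S 0ℓ) → D ⊆ D′ → ν s D → ν s D′

  ↑_ : List S → Pred (Pred S 0ℓ) 0ℓ
  (↑ C) D = ⟦ C ⟧ ⊆ D

  ImageFiniteMonotonic : Set₁
  ImageFiniteMonotonic = ∀ (s : S) → Σ (List (List S)) λ Cs →
    ∀ (D : Pred S 0ℓ) → ν s D ⇔ Any (λ C → (↑ C) D) Cs

  ⋂ν : S → Pred S (suc 0ℓ)
  ⋂ν s t = ∀ (D : Pred S 0ℓ) → ν s D → D t

  -- augmented: monotonic and ⋂ν(s) ∈ ν(s)  (⋂ν(s) is represented by a
  -- level-0 predicate K extensionally equal to it)
  Augmented : Set₁
  Augmented = Monotonic × (∀ (s : S) → Σ (Pred S 0ℓ) λ K → (K ≐ ⋂ν s) × ν s K)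

  krp : KripkeModel At
  krp = record { S = S ; R = ⋂ν ; V = V }

ImageFiniteKripke : {At : Set} → KripkeModel At → Set₁
ImageFiniteKripke K = ∀ (s : S) → Σ (List S) λ L → ∀ (t : S) → R s t ⇔ t ∈ L
  where open KripkeModel K

module Submission where

-- Proposition 4.17 compares three notions of finiteness for a neighbourhood
-- model, all of which are properties of the individual families ν(s).
-- A finitely generated family is determined by Y = C₁ ∪ … ∪ Cₙ.  Conversely,
-- if 𝒩 is upward closed and determined by Y, it is generated by those subsets
-- of Y that belong to 𝒩: every D ∈ 𝒩 contains its trace on Y, which lies in 𝒩.
-- This step decides membership classically (excluded middle), listing the
-- subsets of Y explicitly.  For a family with least element ⋂𝒩 (augmented),
-- finite generation is equivalent to finiteness of ⋂𝒩, as ↑⋂𝒩 = 𝒩.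
-- Part (1) is the first equivalence applied to each ν(s); part (2) chains
-- the second equivalence with the first, since R[s] = ⋂ν(s) in krp(M).

open import Defs
open import Level using (Level; 0ℓ) renaming (suc to lsuc)
open import Data.Bool using (true; false)
open import Data.Product using (Σ; _×_; _,_; proj₁; proj₂)
open import Data.List using (List; []; _∷_; [_]; map; _++_; concat; filter)
open import Data.List.Relation.Unary.Any as Any using (Any; here; there)
open import Data.List.Membership.Propositional using (_∈_; find; lose)
open import Data.List.Membership.Propositional.Properties
  using (∈-++⁺ˡ; ∈-++⁺ʳ; ∈-map⁺; ∈-concat⁺′; ∈-filter⁺; ∈-filter⁻)
open import Function.Bundles using (_⇔_; mk⇔; Equivalence)
open import Axiom.ExcludedMiddle using (ExcludedMiddle)
open import Relation.Nullary using (does)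
open import Relation.Unary using (Pred; Decidable; _⊆_; _≐_; _∩_)
open import Relation.Binary.PropositionalEquality using (refl)

open Equivalence using (to; from)

module _ {S : Set} where

  Family : Set₁
  Family = Pred (Pred S 0ℓ) 0ℓ

  UpwardClosed : Family → Set₁
  UpwardClosed 𝒩 = ∀ (D D′ : Pred S 0ℓ) → D ⊆ D′ → 𝒩 D → 𝒩 D′

  FinitelyGenerated : Family → Set₁
  FinitelyGenerated 𝒩 = Σ (List (List S)) λ Cs →
    ∀ (D : Pred S 0ℓ) → 𝒩 D ⇔ Any (λ C → ⟦ C ⟧ ⊆ D) Cs

  FinitelyDetermined : Family → Set₁
  FinitelyDetermined 𝒩 = Σ (List S) λ Y → Σ Family λ W →
    ExtensionalFamily W × (∀ E → W E → E ⊆ ⟦ Y ⟧) ×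
    (∀ (D : Pred S 0ℓ) → 𝒩 D ⇔ W (D ∩ ⟦ Y ⟧))

  ⋂ : Family → Pred S (lsuc 0ℓ)
  ⋂ 𝒩 t = ∀ (D : Pred S 0ℓ) → 𝒩 D → D t

  HasLeast : Family → Set₁
  HasLeast 𝒩 = Σ (Pred S 0ℓ) λ K → (K ≐ ⋂ 𝒩) × 𝒩 K

  FiniteKernel : Family → Set₁
  FiniteKernel 𝒩 = Σ (List S) λ L → ∀ (t : S) → ⋂ 𝒩 t ⇔ t ∈ L

  -- Finite generation ⇒ finite determination, with Y the union of the
  -- generators: a generator contained in D is contained in D ∩ Y.
  generated⇒determined : ∀ {𝒩} → FinitelyGenerated 𝒩 → FinitelyDetermined 𝒩
  generated⇒determined {𝒩} (Cs , gen) = Y , W , W-ext , (λ _ → proj₁) , determines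
    where
      Y : List S
      Y = concat Cs

      W : Family
      W E = E ⊆ ⟦ Y ⟧ × Any (λ C → ⟦ C ⟧ ⊆ E) Cs

      W-ext : ExtensionalFamily W
      W-ext D D′ (D⊆D′ , D′⊆D) (D⊆Y , D-generated) =
        (λ x∈D′ → D⊆Y (D′⊆D x∈D′)) , Any.map (λ C⊆D {x} x∈C → D⊆D′ (C⊆D x∈C)) D-generated

      generator-in-trace : ∀ {D} → Any (λ C → ⟦ C ⟧ ⊆ D) Cs →
        Any (λ C → ⟦ C ⟧ ⊆ (D ∩ ⟦ Y ⟧)) Cs
      generator-in-trace g with find g
      ... | C , C∈Cs , C⊆D = lose C∈Cs (λ {x} x∈C → C⊆D x∈C , ∈-concat⁺′ x∈C C∈Cs)

      determines : ∀ D → 𝒩 D ⇔ W (D ∩ ⟦ Y ⟧)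
      determines D = mk⇔
        (λ D∈𝒩 → (λ {x} → proj₂) , generator-in-trace (to (gen D) D∈𝒩))
        (λ (_ , g) → from (gen D) (Any.map (λ C⊆D∩Y {x} x∈C → proj₁ (C⊆D∩Y x∈C)) g))

  determined-by-trace : ∀ {𝒩} ((Y , _) : FinitelyDetermined 𝒩) →
    ∀ {D D′} → D ∩ ⟦ Y ⟧ ≐ D′ ∩ ⟦ Y ⟧ → 𝒩 D → 𝒩 D′
  determined-by-trace (Y , W , W-ext , _ , determines) {D} {D′} same-trace D∈𝒩 =
    from (determines D′) (W-ext (D ∩ ⟦ Y ⟧) (D′ ∩ ⟦ Y ⟧) same-trace (to (determines D) D∈𝒩))

  sublists : List S → List (List S)
  sublists []       = [ [] ]
  sublists (x ∷ xs) = map (x ∷_) (sublists xs) ++ sublists xs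

  filter∈sublists : ∀ {P : Pred S 0ℓ} (P? : Decidable P) (Y : List S) →
    filter P? Y ∈ sublists Y
  filter∈sublists P? []       = here refl
  filter∈sublists P? (x ∷ xs) with does (P? x)
  ... | true  = ∈-++⁺ˡ (∈-map⁺ (x ∷_) (filter∈sublists P? xs))
  ... | false = ∈-++⁺ʳ (map (x ∷_) (sublists xs)) (filter∈sublists P? xs)

  filter-≐ : ∀ {P : Pred S 0ℓ} (P? : Decidable P) (Y : List S) →
    ⟦ filter P? Y ⟧ ≐ P ∩ ⟦ Y ⟧
  filter-≐ P? Y =
    (λ x∈filter → let x∈Y , Px = ∈-filter⁻ P? x∈filter in Px , x∈Y) ,
    (λ (Px , x∈Y) → ∈-filter⁺ P? x∈Y Px)

  -- Finite determination ⇒ finite generation for upward-closed families: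
  -- the generators are the subsets of Y lying in 𝒩 (selected classically).
  determined⇒generated : ExcludedMiddle 0ℓ → ∀ {𝒩} → UpwardClosed 𝒩 →
    FinitelyDetermined 𝒩 → FinitelyGenerated 𝒩
  determined⇒generated em {𝒩} upward det@(Y , _) = Cs , generates
    where
      in𝒩? : Decidable (λ C → 𝒩 ⟦ C ⟧)
      in𝒩? _ = em

      Cs : List (List S)
      Cs = filter in𝒩? (sublists Y)

      -- The trace of D ∈ 𝒩 on Y is one of the generators, and lies in D.
      trace-generates : ∀ D → 𝒩 D → Any (λ C → ⟦ C ⟧ ⊆ D) Cs
      trace-generates D D∈𝒩 = lose (∈-filter⁺ in𝒩? (filter∈sublists D? Y) T∈𝒩) T⊆D
        where
          D? : Decidable D
          D? _ = em
          T : List S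
          T = filter D? Y
          T⊆D∩Y = proj₁ (filter-≐ D? Y)
          D∩Y⊆T = proj₂ (filter-≐ D? Y)

          same-trace : D ∩ ⟦ Y ⟧ ≐ ⟦ T ⟧ ∩ ⟦ Y ⟧
          same-trace = (λ x∈D∩Y → D∩Y⊆T x∈D∩Y , proj₂ x∈D∩Y) , λ (x∈T , _) → T⊆D∩Y x∈T

          T∈𝒩 : 𝒩 ⟦ T ⟧
          T∈𝒩 = determined-by-trace det same-trace D∈𝒩

          T⊆D : ⟦ T ⟧ ⊆ D
          T⊆D x∈T = proj₁ (T⊆D∩Y x∈T)

      generates : ∀ D → 𝒩 D ⇔ Any (λ C → ⟦ C ⟧ ⊆ D) Cs
      generates D = mk⇔ (trace-generates D) λ g →
        let C , C∈Cs , C⊆D = find g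
            C∈𝒩 = proj₂ (∈-filter⁻ in𝒩? {xs = sublists Y} C∈Cs)
        in upward ⟦ C ⟧ D C⊆D C∈𝒩

  kernel⇒generated : ∀ {𝒩} → UpwardClosed 𝒩 → HasLeast 𝒩 → FiniteKernel 𝒩 →
    FinitelyGenerated 𝒩
  kernel⇒generated {𝒩} upward (K , K≐⋂ , K∈𝒩) (L , ⋂≐L) = [ L ] , generates
    where
      generates : ∀ D → 𝒩 D ⇔ Any (λ C → ⟦ C ⟧ ⊆ D) [ L ]
      generates D = mk⇔
        (λ D∈𝒩 → here λ {t} t∈L → from (⋂≐L t) t∈L D D∈𝒩)
        (λ { (here L⊆D) → upward K D (λ {t} t∈K → L⊆D (to (⋂≐L t) (proj₁ K≐⋂ t∈K))) K∈𝒩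
          ; (there ()) })

  -- The least element K of a finitely generated family contains some
  -- generator C; as ⟦ C ⟧ itself belongs to the family, ⋂𝒩 = ⟦ C ⟧.
  generated⇒kernel : ∀ {𝒩} → HasLeast 𝒩 → FinitelyGenerated 𝒩 → FiniteKernel 𝒩
  generated⇒kernel {𝒩} (K , K≐⋂ , K∈𝒩) (Cs , gen) = C , kernel≐C
    where
      least-generator = find (to (gen K) K∈𝒩)
      C = proj₁ least-generator
      C∈Cs = proj₁ (proj₂ least-generator)
      C⊆K = proj₂ (proj₂ least-generator)

      C∈𝒩 : 𝒩 ⟦ C ⟧
      C∈𝒩 = from (gen ⟦ C ⟧) (lose C∈Cs λ {x} x∈C → x∈C)

      kernel≐C : ∀ t → ⋂ 𝒩 t ⇔ t ∈ C
      kernel≐C t = mk⇔ (λ t∈⋂ → t∈⋂ ⟦ C ⟧ C∈𝒩) (λ t∈C → proj₁ K≐⋂ (C⊆K t∈C))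

proposition4p17 : (em : ∀ {ℓ : Level} → ExcludedMiddle ℓ) →
    ∀ {At : Set} (M : NeighbourhoodModel At) →
      (Monotonic M → (ImageFiniteMonotonic M ⇔ ImageFiniteNM M)) ×
      (Augmented M → (ImageFiniteKripke (krp M) ⇔ ImageFiniteNM M))
proposition4p17 em M = part1 , part2
  where
    part1 : Monotonic M → (ImageFiniteMonotonic M ⇔ ImageFiniteNM M)
    part1 monotonic = mk⇔
      (λ gen s → generated⇒determined (gen s))
      (λ det s → determined⇒generated em (monotonic s) (det s))

    part2 : Augmented M → (ImageFiniteKripke (krp M) ⇔ ImageFiniteNM M)
    part2 (monotonic , least) = mk⇔
      (λ kernel s → generated⇒determined (kernel⇒generated (monotonic s) (least s) (kernel s)))
      (λ det s → generated⇒kernel (least s) (determined⇒generated em (monotonic s) (det s)))
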